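{- For every $n\geq 2$, the distinguishing number of the book graph $B_n$ is $D(B_n)=\lceil \sqrt{n}\,\rceil$.
   Context: The $n$-book graph $B_n$ ($n\ge 2$) is the Cartesian product $K_{1,n}\,\square\, P_2$ ($K_{1,n}$ the star with $n$ leaves, $P_2$ the path on two vertices; $G\square H$ has vertex set $V(G)\times V(H)$, with $(g,h)\sim(g',h')$ iff $g=g'$ and $hh'\in E(H)$, or $gg'\in E(G)$ and $h=h'$). For a graph $G$, a vertex labeling $\phi:V(G)\to\{1,\dots,r\}$ is $r$-distinguishing if the only automorphism of $G$ preserving all labels is the identity; the distinguishing number $D(G)$ is the least such $r$. -}

module Defs where

open import Level using (0ℓ)
open import Data.Nat using (ℕ; suc; _*_; _≤_; _<_)
open import Data.Fin using (Fin; zero)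
open import Data.Product using (_×_; Σ; ∃; _,_)
open import Data.Sum using (_⊎_)
open import Relation.Nullary using (¬_)
open import Relation.Binary.PropositionalEquality using (_≡_; _≢_)
open import Function.Bundles using (_↔_; _⇔_; Inverse)

record Graph : Set₁ where
  field
    Vertex : Set
    Adj    : Vertex → Vertex → Set
open Graph public

-- Star K_{1,n}: vertex set Fin (suc n), centre = zero, leaves = suc i.
Star : ℕ → Graph
Vertex (Star n) = Fin (suc n)
Adj (Star n) i j = (i ≡ zero × j ≢ zero) ⊎ (i ≢ zero × j ≡ zero)

P₂ : Graph
Vertex P₂ = Fin 2
Adj P₂ h h' = h ≢ h'

_□_ : Graph → Graph → Graph
Vertex (G □ H) = Vertex G × Vertex H
Adj (G □ H) (g , h) (g' , h') =
  (g ≡ g' × Adj H h h') ⊎ (Adj G g g' × h ≡ h')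

Book : ℕ → Graph
Book n = Star n □ P₂

record Automorphism (G : Graph) : Set where
  field
    perm     : Vertex G ↔ Vertex G
    preserve : ∀ u v → Adj G u v ⇔ Adj G (Inverse.to perm u) (Inverse.to perm v)
open Automorphism public

apply : {G : Graph} → Automorphism G → Vertex G → Vertex G
apply σ = Inverse.to (perm σ)

IsDistinguishing : (G : Graph) (r : ℕ) → (Vertex G → Fin r) → Set
IsDistinguishing G r φ =
  (σ : Automorphism G) → (∀ v → φ (apply σ v) ≡ φ v) → ∀ v → apply σ v ≡ v

HasDistinguishingLabeling : Graph → ℕ → Set
HasDistinguishingLabeling G r = Σ (Vertex G → Fin r) (IsDistinguishing G r)

DistinguishingNumber : Graph → ℕ → Set
DistinguishingNumber G d =
  HasDistinguishingLabeling G d × (∀ r → HasDistinguishingLabeling G r → d ≤ r)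

IsCeilSqrt : ℕ → ℕ → Set
IsCeilSqrt n k = n ≤ k * k × (∀ j → n ≤ j * j → k ≤ j)

module Submission where

-- A distinguishing labeling must give the n pages {(i,0),(i,1)} pairwise different label pairs,
-- since swapping two pages with equal labels is a non-trivial label-preserving automorphism;
-- hence n ≤ r². Conversely, if n ≤ k² then k ≥ 2, and we label the pages by distinct pairs and
-- the two centre vertices by 0 and 1. For n ≥ 2 the centre vertices are the only vertices of
-- degree at least 3, so a label-preserving automorphism fixes them; it then maps each page to a
-- page layer by layer, and the page labels force every page to be fixed.

open import Defs
open import Data.Nat using (ℕ; zero; suc; _≤_; _*_; z≤n; s≤s)
open import Data.Fin using (Fin; zero; suc; inject≤; _≟_)
open import Data.Fin.Properties using (suc-injective; injective⇒≤; inject≤-injective; *↔×)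
open import Data.Fin.Permutation using (Permutation′; lift₀; transpose)
import Data.Fin.Permutation.Components as Components
open import Data.Product using (_×_; ∃; _,_; proj₁; proj₂)
open import Data.Product.Function.NonDependent.Propositional using (_×-↔_)
open import Data.Sum using (_⊎_; inj₁; inj₂; [_,_])
open import Data.Empty using (⊥-elim)
open import Relation.Nullary using (¬_; yes; no; contradiction)
open import Relation.Binary.PropositionalEquality hiding ([_])
open import Function using (_∘_; const)
open import Function.Bundles using (Inverse; Injection; Equivalence; mk⇔)
open import Function.Construct.Identity using (↔-id)
open import Function.Properties.Inverse using (↔⇒↣; ↔-sym)
open import Function.Definitions using (Injective)

module _ {G : Graph} (σ : Automorphism G) where

  apply-injective : ∀ {u v} → apply σ u ≡ apply σ v → u ≡ v
  apply-injective = Injection.injective (↔⇒↣ (perm σ))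

  apply-adj : ∀ {u v} → Adj G u v → Adj G (apply σ u) (apply σ v)
  apply-adj {u} {v} = Equivalence.to (preserve σ u v)

two-of-three-equal : ∀ {A : Set} {a b x y z : A} →
  x ≡ a ⊎ x ≡ b → y ≡ a ⊎ y ≡ b → z ≡ a ⊎ z ≡ b → x ≡ y ⊎ x ≡ z ⊎ y ≡ z
two-of-three-equal (inj₁ p) (inj₁ q) _        = inj₁ (trans p (sym q))
two-of-three-equal (inj₂ p) (inj₂ q) _        = inj₁ (trans p (sym q))
two-of-three-equal (inj₁ p) (inj₂ q) (inj₁ r) = inj₂ (inj₁ (trans p (sym r)))
two-of-three-equal (inj₁ p) (inj₂ q) (inj₂ r) = inj₂ (inj₂ (trans q (sym r)))
two-of-three-equal (inj₂ p) (inj₁ q) (inj₁ r) = inj₂ (inj₂ (trans q (sym r)))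
two-of-three-equal (inj₂ p) (inj₁ q) (inj₂ r) = inj₂ (inj₁ (trans p (sym r)))

automorphism-preserves-degree≥3 : ∀ {G : Graph} (σ : Automorphism G) {u v a b w₁ w₂ w₃} →
  Adj G u w₁ → Adj G u w₂ → Adj G u w₃ → w₁ ≢ w₂ → w₁ ≢ w₃ → w₂ ≢ w₃ →
  (∀ w → Adj G v w → w ≡ a ⊎ w ≡ b) → apply σ u ≢ v
automorphism-preserves-degree≥3 {G} σ {u = u} {a = a} {b = b} a₁ a₂ a₃ w₁≢w₂ w₁≢w₃ w₂≢w₃ nbrs σu≡v =
  [ w₁≢w₂ ∘ apply-injective σ , [ w₁≢w₃ ∘ apply-injective σ , w₂≢w₃ ∘ apply-injective σ ] ]
    (two-of-three-equal (image a₁) (image a₂) (image a₃))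
  where
  image : ∀ {w} → Adj G u w → apply σ w ≡ a ⊎ apply σ w ≡ b
  image {w} u~w = nbrs (apply σ w) (subst (λ x → Adj G x (apply σ w)) σu≡v (apply-adj σ u~w))

module _ {n : ℕ} where

  centre-leaf : ∀ {i} → Adj (Star n) zero (suc i)
  centre-leaf = inj₁ (refl , λ ())

  leaf-centre : ∀ {i} → Adj (Star n) (suc i) zero
  leaf-centre = inj₂ ((λ ()) , refl)

  ¬centre-centre : ¬ Adj (Star n) zero zero
  ¬centre-centre (inj₁ (_ , ne)) = ne refl
  ¬centre-centre (inj₂ (ne , _)) = ne refl

  ¬leaf-leaf : ∀ {i j} → ¬ Adj (Star n) (suc i) (suc j)
  ¬leaf-leaf (inj₁ (() , _))
  ¬leaf-leaf (inj₂ (_ , ()))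

leafPermutationAut : ∀ {n} → Permutation′ n → Automorphism (Star n)
perm (leafPermutationAut π) = lift₀ π
preserve (leafPermutationAut π) zero    zero    = mk⇔ (⊥-elim ∘ ¬centre-centre) (⊥-elim ∘ ¬centre-centre)
preserve (leafPermutationAut π) zero    (suc j) = mk⇔ (const centre-leaf) (const centre-leaf)
preserve (leafPermutationAut π) (suc i) zero    = mk⇔ (const leaf-centre) (const leaf-centre)
preserve (leafPermutationAut π) (suc i) (suc j) = mk⇔ (⊥-elim ∘ ¬leaf-leaf) (⊥-elim ∘ ¬leaf-leaf)

□-liftAut : ∀ {G} (H : Graph) → Automorphism G → Automorphism (G □ H)
perm (□-liftAut {G} H σ) = perm σ ×-↔ ↔-id (Vertex H)
preserve (□-liftAut {G} H σ) (g , h) (g' , h') = mk⇔ forward backward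
  where
  forward : Adj (G □ H) (g , h) (g' , h') → Adj (G □ H) (apply σ g , h) (apply σ g' , h')
  forward (inj₁ (g≡g' , h~h')) = inj₁ (cong (apply σ) g≡g' , h~h')
  forward (inj₂ (g~g' , h≡h')) = inj₂ (apply-adj σ g~g' , h≡h')
  backward : Adj (G □ H) (apply σ g , h) (apply σ g' , h') → Adj (G □ H) (g , h) (g' , h')
  backward (inj₁ (σg≡σg' , h~h')) = inj₁ (apply-injective σ σg≡σg' , h~h')
  backward (inj₂ (σg~σg' , h≡h')) = inj₂ (Equivalence.from (preserve σ g g') σg~σg' , h≡h')

transpose-matchˡ : ∀ {m} (i j : Fin m) → Components.transpose i j i ≡ j
transpose-matchˡ i j with i ≟ i
... | yes _  = refl
... | no i≢i = contradiction refl i≢i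

transpose-respects : ∀ {m} {A : Set} (f : Fin m → A) {i j} → f i ≡ f j →
                     ∀ k → f (Components.transpose i j k) ≡ f k
transpose-respects f {i} {j} fi≡fj k with k ≟ i
... | yes refl = sym fi≡fj
... | no _ with k ≟ j
...   | yes refl = fi≡fj
...   | no _     = refl

swapPages : ∀ {n} → Fin n → Fin n → Automorphism (Book n)
swapPages i j = □-liftAut P₂ (leafPermutationAut (transpose i j))

pageLabels : ∀ {n r} → (Vertex (Book n) → Fin r) → Fin n → Fin r × Fin r
pageLabels φ i = φ (suc i , zero) , φ (suc i , suc zero)

-- Two pages with the same labels could be swapped.
distinguishing⇒pageLabels-injective : ∀ {n r} (φ : Vertex (Book n) → Fin r) →
  IsDistinguishing (Book n) r φ → Injective _≡_ _≡_ (pageLabels φ)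
distinguishing⇒pageLabels-injective {n} φ φ-dist {i} {j} same =
  sym (trans (sym (transpose-matchˡ i j)) (suc-injective (cong proj₁ σ-fixes-leaf-i)))
  where
  σ : Automorphism (Book n)
  σ = swapPages i j
  samePage : ∀ h → φ (suc i , h) ≡ φ (suc j , h)
  samePage zero       = cong proj₁ same
  samePage (suc zero) = cong proj₂ same
  preserved : ∀ v → φ (apply σ v) ≡ φ v
  preserved (zero  , h) = refl
  preserved (suc k , h) = transpose-respects (λ l → φ (suc l , h)) (samePage h) k
  σ-fixes-leaf-i : apply σ (suc i , zero) ≡ (suc i , zero)
  σ-fixes-leaf-i = φ-dist σ preserved (suc i , zero)

injection-into-square⇒≤ : ∀ {n r} {f : Fin n → Fin r × Fin r} → Injective _≡_ _≡_ f → n ≤ r * r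
injection-into-square⇒≤ f-inj = injective⇒≤ (f-inj ∘ Injection.injective (↔⇒↣ (↔-sym *↔×)))

distinguishing⇒n≤r² : ∀ {n r} (φ : Vertex (Book n) → Fin r) → IsDistinguishing (Book n) r φ → n ≤ r * r
distinguishing⇒n≤r² φ φ-dist = injection-into-square⇒≤ (distinguishing⇒pageLabels-injective φ φ-dist)

other : Fin 2 → Fin 2
other zero       = suc zero
other (suc zero) = zero

P₂-adj⇒other : ∀ {h h'} → Adj P₂ h h' → h' ≡ other h
P₂-adj⇒other {zero}     {zero}     h≢h' = contradiction refl h≢h'
P₂-adj⇒other {zero}     {suc zero} _    = refl
P₂-adj⇒other {suc zero} {zero}     _    = refl
P₂-adj⇒other {suc zero} {suc zero} h≢h' = contradiction refl h≢h'

P₂-adj-other : ∀ h → Adj P₂ h (other h)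
P₂-adj-other zero       ()
P₂-adj-other (suc zero) ()

leaf-neighbours : ∀ {n i h v} → Adj (Book n) (suc i , h) v → v ≡ (suc i , other h) ⊎ v ≡ (zero , h)
leaf-neighbours (inj₁ (refl , h~h'))   = inj₁ (cong (suc _ ,_) (P₂-adj⇒other h~h'))
leaf-neighbours (inj₂ (inj₁ (() , _) , _))
leaf-neighbours (inj₂ (inj₂ (_ , refl) , refl)) = inj₂ refl

-- A centre vertex has at least three neighbours, a leaf vertex only two.
centre-maps-to-centre : ∀ {n} (σ : Automorphism (Book (suc (suc n)))) h →
                        ∃ λ h' → apply σ (zero , h) ≡ (zero , h')
centre-maps-to-centre σ h with apply σ (zero , h) in σc≡v
... | zero  , h' = h' , refl
... | suc i , h' = contradiction σc≡v
  (automorphism-preserves-degree≥3 σ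
    (inj₁ (refl , P₂-adj-other h))
    (inj₂ (centre-leaf {i = zero} , refl))
    (inj₂ (centre-leaf {i = suc zero} , refl))
    (λ ()) (λ ()) (λ ())
    (λ _ → leaf-neighbours))

squareCode : ∀ {n k} → n ≤ k * k → Fin n → Fin k × Fin k
squareCode {k = k} n≤k² i = Inverse.to (*↔× {k} {k}) (inject≤ i n≤k²)

squareCode-injective : ∀ {n k} (n≤k² : n ≤ k * k) → Injective _≡_ _≡_ (squareCode n≤k²)
squareCode-injective {k = k} n≤k² =
  inject≤-injective n≤k² n≤k² _ _ ∘ Injection.injective (↔⇒↣ (*↔× {k} {k}))

module BookLabeling {n k : ℕ} (2≤k : 2 ≤ k) (code : Fin (suc (suc n)) → Fin k × Fin k)
                    (code-injective : Injective _≡_ _≡_ code) where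

  labeling : Vertex (Book (suc (suc n))) → Fin k
  labeling (zero  , h)        = inject≤ h 2≤k
  labeling (suc i , zero)     = proj₁ (code i)
  labeling (suc i , suc zero) = proj₂ (code i)

  module _ (σ : Automorphism (Book (suc (suc n))))
           (preserved : ∀ v → labeling (apply σ v) ≡ labeling v) where

    centre-fixed : ∀ h → apply σ (zero , h) ≡ (zero , h)
    centre-fixed h with centre-maps-to-centre σ h
    ... | h' , σc≡c' = trans σc≡c' (cong (zero ,_) (inject≤-injective 2≤k 2≤k h' h same-label))
      where
      same-label : inject≤ h' 2≤k ≡ inject≤ h 2≤k
      same-label = trans (cong labeling (sym σc≡c')) (preserved (zero , h))

    leaf-maps-within-layer : ∀ i h → ∃ λ j → apply σ (suc i , h) ≡ (suc j , h)
    leaf-maps-within-layer i h with apply σ (suc i , h) in σl≡v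
    ... | zero , h' = contradiction (apply-injective σ (trans σl≡v (sym (centre-fixed h')))) λ ()
    ... | suc j , h'
      with leaf-neighbours
             (subst₂ (Adj (Book _)) σl≡v (centre-fixed h) (apply-adj σ (inj₂ (leaf-centre , refl))))
    ...   | inj₂ refl = j , refl

    page-maps-to-page : ∀ i → ∃ λ j → ∀ h → apply σ (suc i , h) ≡ (suc j , h)
    page-maps-to-page i with leaf-maps-within-layer i zero | leaf-maps-within-layer i (suc zero)
    ... | j , σi₀ | j' , σi₁
      with leaf-neighbours (subst₂ (Adj (Book _)) σi₀ σi₁ (apply-adj σ (inj₁ (refl , λ ()))))
    ...   | inj₁ refl = j , λ { zero → σi₀ ; (suc zero) → σi₁ }

    leaf-fixed : ∀ i h → apply σ (suc i , h) ≡ (suc i , h)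
    leaf-fixed i h with page-maps-to-page i
    ... | j , σpage = trans (σpage h) (cong (λ l → suc l , h) (code-injective same-code))
      where
      same-code : code j ≡ code i
      same-code = cong₂ _,_ (trans (cong labeling (sym (σpage zero))) (preserved (suc i , zero)))
                            (trans (cong labeling (sym (σpage (suc zero)))) (preserved (suc i , suc zero)))

  labeling-distinguishing : IsDistinguishing (Book (suc (suc n))) k labeling
  labeling-distinguishing σ preserved (zero  , h) = centre-fixed σ preserved h
  labeling-distinguishing σ preserved (suc i , h) = leaf-fixed σ preserved i h

2≤n≤k²⇒2≤k : ∀ {n k} → 2 ≤ n → n ≤ k * k → 2 ≤ k
2≤n≤k²⇒2≤k {k = zero}        (s≤s _)       ()
2≤n≤k²⇒2≤k {k = suc zero}    (s≤s (s≤s _)) (s≤s ())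
2≤n≤k²⇒2≤k {k = suc (suc k)} _             _ = s≤s (s≤s z≤n)

hasDistinguishingLabeling : ∀ {n k} → 2 ≤ n → n ≤ k * k → HasDistinguishingLabeling (Book n) k
hasDistinguishingLabeling {suc (suc n)} {k} 2≤n@(s≤s (s≤s _)) n≤k² = labeling , labeling-distinguishing
  where
  open BookLabeling (2≤n≤k²⇒2≤k {k = k} 2≤n n≤k²) (squareCode {k = k} n≤k²) (squareCode-injective n≤k²)

mainTheorem5 : ∀ (n k : ℕ) → 2 ≤ n → IsCeilSqrt n k → DistinguishingNumber (Book n) k
mainTheorem5 n k 2≤n (n≤k² , k-least) =
  hasDistinguishingLabeling 2≤n n≤k² ,
  λ r (φ , φ-distinguishing) → k-least r (distinguishing⇒n≤r² φ φ-distinguishing)
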